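{- Let $a,b$ be integers with $2\leq a\leq b$, and let $K_{a,b}$ be the complete bipartite graph with parts of sizes $a$ and $b$. Then $\pi_3(K_{a,b})=\left\lfloor \frac{a}{2}\right\rfloor$.
   Context: All graphs are finite, simple and undirected. For a graph $G$ and $S\subseteq V(G)$ with $|S|\geq 2$, an $S$-path is a subgraph of $G$ that is a path containing all vertices of $S$; two $S$-paths $P,P'$ are internally disjoint if $E(P)\cap E(P')=\varnothing$ and $V(P)\cap V(P')=S$. $\pi_G(S)$ is the maximum number of pairwise internally disjoint $S$-paths, and for $2\leq k\leq |V(G)|$, $\pi_k(G)=\min\{\pi_G(S): S\subseteq V(G), |S|=k\}$. -}

module Defs where

open import Level using (0ℓ)
open import Data.Nat using (ℕ; _+_; _≤_; _<_; _/_)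
open import Data.Fin using (Fin; toℕ)
open import Data.Fin.Subset using (Subset; _∈_; ∣_∣)
open import Data.List using (List; []; _∷_; length)
import Data.List.Membership.Propositional as LM
open import Data.List.Relation.Unary.Unique.Propositional using (Unique)
open import Data.List.Relation.Unary.Linked using (Linked)
open import Data.List.Relation.Unary.AllPairs using (AllPairs)
open import Data.Product using (Σ; _×_; ∃)
open import Data.Sum using (_⊎_)
open import Data.Empty using (⊥)
open import Relation.Binary.PropositionalEquality using (_≡_)
open import Relation.Nullary using (¬_)

record Graph (n : ℕ) : Set₁ where
  field
    Adj     : Fin n → Fin n → Set
    sym     : ∀ {u v} → Adj u v → Adj v u
    irrefl  : ∀ {u} → ¬ Adj u u

open Graph public

-- Complete bipartite graph K_{a,b}: vertices Fin (a + b); the first a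
-- vertices (toℕ < a) form one part, the remaining b the other.
KAdj : (a b : ℕ) → Fin (a + b) → Fin (a + b) → Set
KAdj a b u v = (toℕ u < a × a ≤ toℕ v) ⊎ (a ≤ toℕ u × toℕ v < a)

K : (a b : ℕ) → Graph (a + b)
K a b = record { Adj = KAdj a b ; sym = s ; irrefl = i }
  where
  open import Data.Sum using (inj₁; inj₂)
  open import Data.Product using (_,_)
  open import Data.Nat.Properties using (<⇒≱)
  s : ∀ {u v} → KAdj a b u v → KAdj a b v u
  s (inj₁ (p , q)) = inj₂ (q , p)
  s (inj₂ (p , q)) = inj₁ (q , p)
  i : ∀ {u} → ¬ KAdj a b u u
  i (inj₁ (p , q)) = <⇒≱ p q
  i (inj₂ (p , q)) = <⇒≱ q p

data Consec {n : ℕ} : List (Fin n) → Fin n → Fin n → Set where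
  here  : ∀ {x y xs} → Consec (x ∷ y ∷ xs) x y
  there : ∀ {z xs x y} → Consec xs x y → Consec (z ∷ xs) x y

record Path {n : ℕ} (G : Graph n) : Set where
  field
    verts    : List (Fin n)
    distinct : Unique verts
    walk     : Linked (Adj G) verts

open Path public

VertexOf : ∀ {n} {G : Graph n} → Path G → Fin n → Set
VertexOf P v = v LM.∈ verts P

EdgeOf : ∀ {n} {G : Graph n} → Path G → Fin n → Fin n → Set
EdgeOf P u v = Consec (verts P) u v ⊎ Consec (verts P) v u

record SPath {n : ℕ} (G : Graph n) (S : Subset n) : Set where
  field
    path   : Path G
    covers : ∀ v → v ∈ S → VertexOf path v

open SPath public

-- Internally disjoint: no common edge, and common vertices are exactly S
-- (S is contained in both by definition of S-path).
InternallyDisjoint : ∀ {n} {G : Graph n} {S : Subset n} →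
                     SPath G S → SPath G S → Set
InternallyDisjoint {S = S} P Q =
  (∀ u v → EdgeOf (path P) u v → EdgeOf (path Q) u v → ⊥) ×
  (∀ v → VertexOf (path P) v → VertexOf (path Q) v → v ∈ S)

HasDisjointSPaths : ∀ {n} → Graph n → Subset n → ℕ → Set
HasDisjointSPaths G S m =
  Σ (List (SPath G S)) λ Ps → length Ps ≡ m × AllPairs InternallyDisjoint Ps

IsPiS : ∀ {n} → Graph n → Subset n → ℕ → Set
IsPiS G S m = HasDisjointSPaths G S m × (∀ m' → HasDisjointSPaths G S m' → m' ≤ m)

IsPik : ∀ {n} → Graph n → ℕ → ℕ → Set
IsPik {n} G k m =
  (Σ (Subset n) λ S → ∣ S ∣ ≡ k × IsPiS G S m) ×
  (∀ (S : Subset n) → ∣ S ∣ ≡ k → ∀ m' → IsPiS G S m' → m ≤ m')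

module Submission where

-- Write k = ⌊a/2⌋.  Lower bound: every 3-set S is joined by k internally disjoint S-paths.
-- We work with paths as sequences of labels (A = [0, a) and B = [a, a + b) are the parts)
-- and realise them as paths of K a b at the end.  For each of the four ways three
-- terminals can be spread over the parts we give k explicit paths on canonical terminals,
-- built by interleaving A- and B-vertices; each path owns its non-terminal vertices, which
-- makes the paths internally disjoint (lemma assemble).  A symmetry of K_{a,b}, a product
-- of transpositions inside the parts, then carries the canonical terminals onto S.
-- Upper bound: when the three terminals lie in B (possible for b ≥ 3) an S-path alternates
-- between the parts, so it has two A-vertices of its own, and m such paths force 2m ≤ a.
-- For a = b = 2, K_{2,2} is a 4-cycle where {0, 1, 2} has no two disjoint paths.
-- The file develops generic list facts, subsets, the label model of K_{a,b} with its
-- symmetries, the lower and upper bounds, the case K_{2,2}, and finally the theorem.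

open import Defs hiding (sym)

open import Data.Bool using (true; false)
open import Data.Empty using (⊥; ⊥-elim)
open import Data.Fin using (Fin; zero; suc; toℕ; fromℕ<)
open import Data.Fin.Properties using (toℕ-injective; toℕ-fromℕ<; toℕ<n) renaming (suc-injective to fin-suc-injective)
open import Data.Vec using ([]; _∷_; here; there)
import Data.Vec as Vec
open import Data.Nat.DivMod using (m≥n⇒m/n>0; m/n*n≤m; m*n/n≡m; /-monoˡ-≤)
open import Data.Fin.Subset using (Subset; ∣_∣) renaming (_∈_ to _∈ˢ_; ⊥ to ∅)
open import Data.Fin.Subset.Properties using (∣⊥∣≡0)
open import Data.List using (List; []; _∷_; _++_; length; map; filter; concat; applyUpTo; upTo; tabulate)
open import Data.List.Properties using (length-map; length-++; length-tabulate; length-applyUpTo; length-upTo; filter-accept; filter-reject; map-cong-local)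
open import Data.List.Membership.Propositional using (_∈_)
open import Data.List.Membership.Propositional.Properties using (∈-map⁺; ∈-map⁻; ∈-∃++; ∈-++⁻; ∈-++⁺ˡ; ∈-++⁺ʳ; ∈-applyUpTo⁺; ∈-upTo⁺; ∈-filter⁺; ∈-filter⁻)
open import Data.List.Relation.Unary.Any using (here; there)
open import Data.List.Relation.Unary.All as All using (All; []; _∷_)
import Data.List.Relation.Unary.All.Properties as All
open import Data.List.Relation.Unary.AllPairs as AllPairs using (AllPairs; []; _∷_)
import Data.List.Relation.Unary.AllPairs.Properties as AllPairs
open import Data.List.Relation.Unary.Linked as Linked using (Linked; []; [-]; _∷_)
import Data.List.Relation.Unary.Linked.Properties as Linked
open import Data.List.Relation.Unary.Unique.Propositional using (Unique)
open import Data.List.Relation.Binary.Pointwise using (Pointwise; []; _∷_)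
open import Data.List.Relation.Binary.Permutation.Propositional using (_↭_; prep; swap; ↭-refl; ↭-sym; ↭-trans)
open import Data.List.Relation.Binary.Permutation.Propositional.Properties using (∈-resp-↭)
import Data.List.Relation.Unary.Unique.Propositional.Properties as Unique
open import Data.Nat using (ℕ; zero; suc; _+_; _*_; _∸_; _≤_; _<_; z≤n; s≤s; _/_; ⌊_/2⌋; ⌈_/2⌉; _<?_; _≤?_; s≤s⁻¹)
open import Data.Nat.Properties
open import Data.Product as Product using (Σ; _×_; _,_; proj₁; proj₂)
open import Data.Sum as Sum using (_⊎_; inj₁; inj₂)
open import Relation.Binary.PropositionalEquality using (_≡_; _≢_; refl; sym; trans; cong; cong₂; subst; subst₂)
open import Relation.Nullary using (¬_; yes; no)

data Step {A : Set} : List A → A → A → Set where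
  here  : ∀ {x y xs} → Step (x ∷ y ∷ xs) x y
  there : ∀ {z xs x y} → Step xs x y → Step (z ∷ xs) x y

Edge : {A : Set} → List A → A → A → Set
Edge l x y = Step l x y ⊎ Step l y x

module _ {A : Set} where

  step-∈ : ∀ {l : List A} {x y} → Step l x y → x ∈ l × y ∈ l
  step-∈ here      = here refl , there (here refl)
  step-∈ (there s) = Product.map there there (step-∈ s)

  edge-∈ : ∀ {l : List A} {x y} → Edge l x y → x ∈ l × y ∈ l
  edge-∈ (inj₁ s) = step-∈ s
  edge-∈ (inj₂ s) = Product.swap (step-∈ s)

  step-rel : ∀ {R : A → A → Set} {l x y} → Linked R l → Step l x y → R x y
  step-rel (r ∷ _)  here      = r
  step-rel (_ ∷ rs) (there s) = step-rel rs s
  step-rel [-]      (there ())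

  step-map⁺ : ∀ {B : Set} (f : A → B) {l x y} → Step l x y → Step (map f l) (f x) (f y)
  step-map⁺ f here      = here
  step-map⁺ f (there s) = there (step-map⁺ f s)

  edge-map⁺ : ∀ {B : Set} (f : A → B) {l x y} → Edge l x y → Edge (map f l) (f x) (f y)
  edge-map⁺ f = Sum.map (step-map⁺ f) (step-map⁺ f)

  step-map⁻ : ∀ {B : Set} (f : A → B) l {u v} → Step (map f l) u v →
              Σ A λ x → Σ A λ y → Step l x y × f x ≡ u × f y ≡ v
  step-map⁻ f (x ∷ y ∷ l) here = x , y , here , refl , refl
  step-map⁻ f (_ ∷ l) (there s) with step-map⁻ f l s
  ... | x , y , s′ , fx , fy = x , y , there s′ , fx , fy

  module _ {B : Set} {f : A → B} (inj : ∀ {x y} → f x ≡ f y → x ≡ y) where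

    edge-map-inj⁻ : ∀ {l x y} → Edge (map f l) (f x) (f y) → Edge l x y
    edge-map-inj⁻ {l} (inj₁ s) with step-map⁻ f l s
    ... | _ , _ , s′ , fx , fy rewrite inj fx | inj fy = inj₁ s′
    edge-map-inj⁻ {l} (inj₂ s) with step-map⁻ f l s
    ... | _ , _ , s′ , fy , fx rewrite inj fx | inj fy = inj₂ s′

    ∈-map-inj⁻ : ∀ {l x} → f x ∈ map f l → x ∈ l
    ∈-map-inj⁻ x∈ with ∈-map⁻ f x∈
    ... | _ , y∈ , fx≡fy rewrite inj fx≡fy = y∈

  unique-⊆-length : ∀ {xs ys : List A} → Unique xs → (∀ {v} → v ∈ xs → v ∈ ys) → length xs ≤ length ys
  unique-⊆-length {[]} _ _ = z≤n
  unique-⊆-length {x ∷ xs} {ys} (x∉xs ∷ uxs) xs⊆ys with ∈-∃++ (xs⊆ys (here refl))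
  ... | pre , post , refl = begin
      suc (length xs)                 ≤⟨ s≤s (unique-⊆-length uxs shrink) ⟩
      suc (length (pre ++ post))      ≡⟨ cong suc (length-++ pre) ⟩
      suc (length pre + length post)  ≡⟨ +-suc (length pre) (length post) ⟨
      length pre + suc (length post)  ≡⟨ length-++ pre ⟨
      length (pre ++ x ∷ post)        ∎
    where
    open ≤-Reasoning
    shrink : ∀ {v} → v ∈ xs → v ∈ pre ++ post
    shrink v∈xs with ∈-++⁻ pre (xs⊆ys (there v∈xs))
    ... | inj₁ v∈pre          = ∈-++⁺ˡ v∈pre
    ... | inj₂ (here refl)    = ⊥-elim (All.lookup x∉xs v∈xs refl)
    ... | inj₂ (there v∈post) = ∈-++⁺ʳ pre v∈post

  three≤length : ∀ {p q r : A} {ys} → p ≢ q → p ≢ r → q ≢ r → p ∈ ys → q ∈ ys → r ∈ ys → 3 ≤ length ys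
  three≤length p≢q p≢r q≢r p∈ q∈ r∈ =
    unique-⊆-length ((p≢q ∷ p≢r ∷ []) ∷ (q≢r ∷ []) ∷ [] ∷ [])
      λ { (here refl) → p∈ ; (there (here refl)) → q∈ ; (there (there (here refl))) → r∈ }

  ∉3 : ∀ {x p q r : A} → x ≢ p → x ≢ q → x ≢ r → x ∈ p ∷ q ∷ r ∷ [] → ⊥
  ∉3 x≢p _ _ (here e)                 = x≢p e
  ∉3 _ x≢q _ (there (here e))         = x≢q e
  ∉3 _ _ x≢r (there (there (here e))) = x≢r e

  length-concat≥ : ∀ {c} {Ls : List (List A)} → All (λ l → c ≤ length l) Ls → length Ls * c ≤ length (concat Ls)
  length-concat≥ [] = z≤n
  length-concat≥ {Ls = l ∷ _} (c≤l ∷ rest) = subst (_ ≤_) (sym (length-++ l)) (+-mono-≤ c≤l (length-concat≥ rest))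

  predecessor : ∀ {x xs u} → u ∈ xs → Σ A λ w → Step (x ∷ xs) w u
  predecessor {x} (here refl) = x , here
  predecessor (there u∈)      = let w , s = predecessor u∈ in w , there s

  has-neighbour : ∀ {l : List A} {u v} → u ≢ v → u ∈ l → v ∈ l → Σ A λ w → Edge l u w
  has-neighbour {x ∷ y ∷ _} _ (here refl) _ = y , inj₁ here
  has-neighbour {_ ∷ _} _ (there u∈) _     = let w , s = predecessor u∈ in w , inj₂ s
  has-neighbour {x ∷ []} u≢v (here refl) (here refl) = ⊥-elim (u≢v refl)

  interleave : List A → List A → List A
  interleave []       ys = []
  interleave (x ∷ xs) ys = x ∷ interleave ys xs

  ∈-interleave⁻ : ∀ {xs ys v} → v ∈ interleave xs ys → v ∈ xs ⊎ v ∈ ys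
  ∈-interleave⁻ {x ∷ xs} (here v≡x) = inj₁ (here v≡x)
  ∈-interleave⁻ {x ∷ xs} {ys} (there v∈) = Sum.map₁ there (Sum.swap (∈-interleave⁻ {ys} v∈))

  interleave-all : ∀ {P : A → Set} {xs ys} → All P xs → All P ys → All P (interleave xs ys)
  interleave-all pxs pys = All.tabulate λ v∈ → Sum.[ All.lookup pxs , All.lookup pys ] (∈-interleave⁻ v∈)

  interleave-unique : ∀ {xs ys} → Unique xs → Unique ys → (∀ {v} → v ∈ xs → v ∈ ys → ⊥) →
                      Unique (interleave xs ys)
  interleave-unique {[]} _ _ _ = []
  interleave-unique {x ∷ xs} {ys} (x∉xs ∷ uxs) uys apart =
    All.tabulate fresh ∷ interleave-unique uys uxs (λ v∈ys v∈xs → apart (there v∈xs) v∈ys)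
    where
    fresh : ∀ {v} → v ∈ interleave ys xs → x ≢ v
    fresh v∈ refl with ∈-interleave⁻ {ys} v∈
    ... | inj₁ x∈ys = apart (here refl) x∈ys
    ... | inj₂ x∈xs = All.lookup x∉xs x∈xs refl

  interleave-linked : ∀ {P Q : A → Set} {R : A → A → Set} {xs ys} →
                      (∀ {x y} → P x → Q y → R x y) → (∀ {x y} → Q x → P y → R x y) →
                      All P xs → All Q ys → Linked R (interleave xs ys)
  interleave-linked pq qp []         _          = []
  interleave-linked pq qp (_ ∷ _)    []         = [-]
  interleave-linked pq qp (px ∷ pxs) (qy ∷ qys) = pq px qy ∷ interleave-linked qp pq (qy ∷ qys) pxs

elements : ∀ {m} → Subset m → List (Fin m)
elements []          = []
elements (true ∷ p)  = zero ∷ map suc (elements p)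
elements (false ∷ p) = map suc (elements p)

elements-length : ∀ {m} (p : Subset m) → length (elements p) ≡ ∣ p ∣
elements-length []          = refl
elements-length (true ∷ p)  = cong suc (trans (length-map suc (elements p)) (elements-length p))
elements-length (false ∷ p) = trans (length-map suc (elements p)) (elements-length p)

elements-sound : ∀ {m} (p : Subset m) {v} → v ∈ elements p → v ∈ˢ p
elements-sound (true ∷ p) (here refl) = here
elements-sound (true ∷ p) (there v∈) with ∈-map⁻ suc v∈
... | _ , w∈ , refl = there (elements-sound p w∈)
elements-sound (false ∷ p) v∈ with ∈-map⁻ suc v∈
... | _ , w∈ , refl = there (elements-sound p w∈)

elements-complete : ∀ {m} (p : Subset m) {v} → v ∈ˢ p → v ∈ elements p
elements-complete (true ∷ p)  here      = here refl
elements-complete (true ∷ p)  (there v) = there (∈-map⁺ suc (elements-complete p v))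
elements-complete (false ∷ p) (there v) = ∈-map⁺ suc (elements-complete p v)

elements-unique : ∀ {m} (p : Subset m) → Unique (elements p)
elements-unique []          = []
elements-unique (true ∷ p)  = All.tabulate zero∉ ∷ Unique.map⁺ fin-suc-injective (elements-unique p)
  where
  zero∉ : ∀ {v} → v ∈ map suc (elements p) → zero ≢ v
  zero∉ v∈ refl with ∈-map⁻ suc v∈
  ... | _ , _ , ()
elements-unique (false ∷ p) = Unique.map⁺ fin-suc-injective (elements-unique p)

memberLabels : ∀ {m} → Subset m → List ℕ
memberLabels S = map toℕ (elements S)

memberLabels-length : ∀ {m} (S : Subset m) → length (memberLabels S) ≡ ∣ S ∣
memberLabels-length S = trans (length-map toℕ (elements S)) (elements-length S)

memberLabels-unique : ∀ {m} (S : Subset m) → Unique (memberLabels S)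
memberLabels-unique S = Unique.map⁺ toℕ-injective (elements-unique S)

labels : ∀ {m} {G : Graph m} → Path G → List ℕ
labels P = map toℕ (verts P)

consec⇒step : ∀ {m} {l : List (Fin m)} {u v} → Consec l u v → Step l u v
consec⇒step here      = here
consec⇒step (there c) = there (consec⇒step c)

step⇒consec : ∀ {m} {l : List (Fin m)} {u v} → Step l u v → Consec l u v
step⇒consec here      = here
step⇒consec (there s) = there (step⇒consec s)

module _ {m} {G : Graph m} (P : Path G) where

  edgeOf⇒edge : ∀ {u v} → EdgeOf P u v → Edge (verts P) u v
  edgeOf⇒edge = Sum.map consec⇒step consec⇒step

  edge-adj : ∀ {u v} → EdgeOf P u v → Adj G u v
  edge-adj (inj₁ c) = step-rel (walk P) (consec⇒step c)
  edge-adj (inj₂ c) = Graph.sym G (step-rel (walk P) (consec⇒step c))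

  path-neighbour : ∀ {u v} → u ≢ v → VertexOf P u → VertexOf P v → Σ (Fin m) λ w → EdgeOf P u w
  path-neighbour u≢v u∈ v∈ with has-neighbour u≢v u∈ v∈
  ... | w , inj₁ s = w , inj₁ (step⇒consec s)
  ... | w , inj₂ s = w , inj₂ (step⇒consec s)

module KModel (a b : ℕ) where

  n : ℕ
  n = a + b

  B : ℕ → ℕ
  B j = a + j

  B<n : ∀ {j} → j < b → B j < n
  B<n = +-monoʳ-< a

  A<n : ∀ {x} → x < a → x < n
  A<n x<a = ≤-trans x<a (m≤m+n a b)

  a≤B : ∀ j → a ≤ B j
  a≤B = m≤m+n a

  A≢B : ∀ {x y} → x < a → a ≤ y → x ≢ y
  A≢B x<a a≤y refl = <⇒≱ x<a a≤y

  B≢A : ∀ {x y} → y < a → B x ≢ y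
  B≢A {x} y<a e = A≢B y<a (a≤B x) (sym e)

  B-injective : ∀ {i j} → B i ≡ B j → i ≡ j
  B-injective = +-cancelˡ-≡ a _ _

  B-enumerates : ∀ {x} → a ≤ x → x < n → x ∈ applyUpTo B b
  B-enumerates {x} a≤x x<n = subst (_∈ applyUpTo B b) (m+[n∸m]≡n a≤x)
    (∈-applyUpTo⁺ B (+-cancelˡ-< a (x ∸ a) b (subst (_< n) (sym (m+[n∸m]≡n a≤x)) x<n)))

  -- Adjacency of K_{a,b}; Adj (K a b) u v unfolds to Cross (toℕ u) (toℕ v).
  Cross : ℕ → ℕ → Set
  Cross x y = (x < a × a ≤ y) ⊎ (a ≤ x × y < a)

  record KPath (l : List ℕ) : Set where
    constructor kpath
    field
      unique      : Unique l
      alternating : Linked Cross l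
      inRange     : All (_< n) l

  zigzag : ∀ {js is} → Unique js → All (_< b) js → Unique is → All (_< a) is →
           KPath (interleave (map B js) is) × KPath (interleave is (map B js))
  zigzag {js} {is} ujs js<b uis is<a =
    kpath (interleave-unique uBs uis (λ v∈Bs v∈is → apart v∈is v∈Bs))
          (interleave-linked (λ x∈B y∈A → inj₂ (proj₁ x∈B , y∈A)) (λ x∈A y∈B → inj₁ (x∈A , proj₁ y∈B)) Bs∈B is<a)
          (interleave-all Bs<n As<n) ,
    kpath (interleave-unique uis uBs apart)
          (interleave-linked (λ x∈A y∈B → inj₁ (x∈A , proj₁ y∈B)) (λ x∈B y∈A → inj₂ (proj₁ x∈B , y∈A)) is<a Bs∈B)
          (interleave-all As<n Bs<n)
    where
    uBs : Unique (map B js)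
    uBs = Unique.map⁺ (+-cancelˡ-≡ a _ _) ujs
    Bs∈B : All (λ y → a ≤ y × y < n) (map B js)
    Bs∈B = All.map⁺ (All.map (λ {j} j<b → a≤B j , B<n j<b) js<b)
    Bs<n : All (_< n) (map B js)
    Bs<n = All.map proj₂ Bs∈B
    As<n : All (_< n) is
    As<n = All.map A<n is<a
    apart : ∀ {v} → v ∈ is → v ∈ map B js → ⊥
    apart v∈is v∈Bs = A≢B (All.lookup is<a v∈is) (proj₁ (All.lookup Bs∈B v∈Bs)) refl

  Through : (ℕ → Set) → List ℕ → Set
  Through T l = ∀ x → T x → x ∈ l

  record TPath (T : ℕ → Set) : Set where
    constructor tpath
    field
      seq     : List ℕ
      isPath  : KPath seq
      through : Through T seq

  open KPath public
  open TPath public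

  Disjoint : (ℕ → Set) → List ℕ → List ℕ → Set
  Disjoint T l l′ = (∀ x y → Edge l x y → Edge l′ x y → ⊥) × (∀ x → x ∈ l → x ∈ l′ → T x)

  System : (ℕ → Set) → ℕ → Set
  System T k = Σ (List (TPath T)) λ Ps → length Ps ≡ k × AllPairs (λ P Q → Disjoint T (seq P) (seq Q)) Ps

  toFin : (l : List ℕ) → All (_< n) l → List (Fin n)
  toFin []      []          = []
  toFin (x ∷ l) (x<n ∷ l<n) = fromℕ< x<n ∷ toFin l l<n

  labels-toFin : ∀ l (l<n : All (_< n) l) → map toℕ (toFin l l<n) ≡ l
  labels-toFin []      []          = refl
  labels-toFin (x ∷ l) (x<n ∷ l<n) = cong₂ _∷_ (toℕ-fromℕ< x<n) (labels-toFin l l<n)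

  module _ (S : Subset n) (T : ℕ → Set)
           (S⇒T : ∀ v → v ∈ˢ S → T (toℕ v)) (T⇒S : ∀ v → T (toℕ v) → v ∈ˢ S) where

    realisePath : TPath T → SPath (K a b) S
    realisePath (tpath l (kpath u alt l<n) th) = record { path = P ; covers = cover }
      where
      same : map toℕ (toFin l l<n) ≡ l
      same = labels-toFin l l<n
      P : Path (K a b)
      P = record { verts    = toFin l l<n
                 ; distinct = Unique.map⁻ (subst Unique (sym same) u)
                 ; walk     = Linked.map⁻ (subst (Linked Cross) (sym same) alt) }
      cover : ∀ v → v ∈ˢ S → VertexOf P v
      cover v v∈S = ∈-map-inj⁻ toℕ-injective (subst (toℕ v ∈_) (sym same) (th (toℕ v) (S⇒T v v∈S)))

    realise-labels : ∀ P → labels (path (realisePath P)) ≡ seq P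
    realise-labels (tpath l (kpath _ _ l<n) _) = labels-toFin l l<n

    realise-disjoint : ∀ P Q → Disjoint T (seq P) (seq Q) → InternallyDisjoint (realisePath P) (realisePath Q)
    realise-disjoint P Q (noEdge , shared) =
      (λ u v eP eQ → noEdge (toℕ u) (toℕ v) (edge P eP) (edge Q eQ)) ,
      (λ v vP vQ → T⇒S v (shared (toℕ v) (vertex P vP) (vertex Q vQ)))
      where
      vertex : ∀ R {v} → VertexOf (path (realisePath R)) v → toℕ v ∈ seq R
      vertex R v∈ = subst (_ ∈_) (realise-labels R) (∈-map⁺ toℕ v∈)
      edge : ∀ R {u v} → EdgeOf (path (realisePath R)) u v → Edge (seq R) (toℕ u) (toℕ v)
      edge R {u} {v} e = subst (λ l → Edge l (toℕ u) (toℕ v)) (realise-labels R) (edge-map⁺ toℕ (edgeOf⇒edge (path (realisePath R)) e))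

    realise : ∀ {k} → System T k → HasDisjointSPaths (K a b) S k
    realise (Ps , size , disjoint) =
      map realisePath Ps , trans (length-map realisePath Ps) size ,
      AllPairs.map⁺ (AllPairs.map (λ {P} {Q} → realise-disjoint P Q) disjoint)

  SamePart : ℕ → ℕ → Set
  SamePart x y = (x < a × y < a) ⊎ (a ≤ x × a ≤ y)

  A~ : ∀ {x y} → x < a → y < a → SamePart x y
  A~ x<a y<a = inj₁ (x<a , y<a)

  B~ : ∀ {x y} → a ≤ x → a ≤ y → SamePart x y
  B~ a≤x a≤y = inj₂ (a≤x , a≤y)

  samePart-refl : ∀ x → SamePart x x
  samePart-refl x with x <? a
  ... | yes x<a = inj₁ (x<a , x<a)
  ... | no  x≮a = inj₂ (≮⇒≥ x≮a , ≮⇒≥ x≮a)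

  samePart-sym : ∀ {x y} → SamePart x y → SamePart y x
  samePart-sym = Sum.map Product.swap Product.swap

  samePart-trans : ∀ {x y z} → SamePart x y → SamePart y z → SamePart x z
  samePart-trans (inj₁ (x<a , _))   (inj₁ (_ , z<a))   = inj₁ (x<a , z<a)
  samePart-trans (inj₂ (a≤x , _))   (inj₂ (_ , a≤z))   = inj₂ (a≤x , a≤z)
  samePart-trans (inj₁ (_ , y<a))   (inj₂ (a≤y , _))   = ⊥-elim (<⇒≱ y<a a≤y)
  samePart-trans (inj₂ (_ , a≤y))   (inj₁ (y<a , _))   = ⊥-elim (<⇒≱ y<a a≤y)

  cross-resp : ∀ {x y x′ y′} → SamePart x x′ → SamePart y y′ → Cross x y → Cross x′ y′
  cross-resp (inj₁ (_ , x′<a)) (inj₂ (_ , a≤y′)) _ = inj₁ (x′<a , a≤y′)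
  cross-resp (inj₂ (_ , a≤x′)) (inj₁ (_ , y′<a)) _ = inj₂ (a≤x′ , y′<a)
  cross-resp (inj₁ (x<a , _)) (inj₁ (y<a , _)) (inj₁ (_ , a≤y)) = ⊥-elim (<⇒≱ y<a a≤y)
  cross-resp (inj₁ (x<a , _)) (inj₁ (y<a , _)) (inj₂ (a≤x , _)) = ⊥-elim (<⇒≱ x<a a≤x)
  cross-resp (inj₂ (a≤x , _)) (inj₂ (a≤y , _)) (inj₁ (x<a , _)) = ⊥-elim (<⇒≱ x<a a≤x)
  cross-resp (inj₂ (a≤x , _)) (inj₂ (a≤y , _)) (inj₂ (_ , y<a)) = ⊥-elim (<⇒≱ y<a a≤y)

  Respects : (ℕ → ℕ) → Set
  Respects σ = ∀ x → SamePart x (σ x) × (x < n → σ x < n)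

  record Symmetry : Set where
    field
      to from  : ℕ → ℕ
      from-to  : ∀ x → from (to x) ≡ x
      to-from  : ∀ x → to (from x) ≡ x
      to-resp  : Respects to
      from-resp : Respects from

    to-injective : ∀ {x y} → to x ≡ to y → x ≡ y
    to-injective {x} {y} e = trans (sym (from-to x)) (trans (cong from e) (from-to y))

  open Symmetry

  identity : Symmetry
  identity = record { to = λ x → x ; from = λ x → x ; from-to = λ _ → refl ; to-from = λ _ → refl
                    ; to-resp = resp ; from-resp = resp }
    where
    resp : Respects (λ x → x)
    resp x = samePart-refl x , λ x<n → x<n

  -- first ρ, then σ
  _∘ˢ_ : Symmetry → Symmetry → Symmetry
  σ ∘ˢ ρ = record
    { to        = λ x → to σ (to ρ x)
    ; from      = λ x → from ρ (from σ x)
    ; from-to   = λ x → trans (cong (from ρ) (from-to σ (to ρ x))) (from-to ρ x)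
    ; to-from   = λ x → trans (cong (to σ) (to-from ρ (from σ x))) (to-from σ x)
    ; to-resp   = λ x → compose (to-resp ρ x) (to-resp σ (to ρ x))
    ; from-resp = λ x → compose (from-resp σ x) (from-resp ρ (from σ x)) }
    where
    compose : ∀ {x y z} → SamePart x y × (x < n → y < n) → SamePart y z × (y < n → z < n) →
              SamePart x z × (x < n → z < n)
    compose (xy , xy<) (yz , yz<) = samePart-trans xy yz , λ x<n → yz< (xy< x<n)

  transpose : ℕ → ℕ → ℕ → ℕ
  transpose u v x with x ≟ u | x ≟ v
  ... | yes _ | _     = v
  ... | no _  | yes _ = u
  ... | no _  | no _  = x

  transpose-cases : ∀ u v x → (x ≡ u × transpose u v x ≡ v) ⊎ (x ≡ v × transpose u v x ≡ u) ⊎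
                                (x ≢ u × x ≢ v × transpose u v x ≡ x)
  transpose-cases u v x with x ≟ u | x ≟ v
  ... | yes x≡u | _       = inj₁ (x≡u , refl)
  ... | no _    | yes x≡v = inj₂ (inj₁ (x≡v , refl))
  ... | no x≢u  | no x≢v  = inj₂ (inj₂ (x≢u , x≢v , refl))

  transpose-left : ∀ u v → transpose u v u ≡ v
  transpose-left u v with transpose-cases u v u
  ... | inj₁ (_ , e)              = e
  ... | inj₂ (inj₁ (u≡v , e))     = trans e u≡v
  ... | inj₂ (inj₂ (u≢u , _))     = ⊥-elim (u≢u refl)

  transpose-right : ∀ u v → transpose u v v ≡ u
  transpose-right u v with transpose-cases u v v
  ... | inj₁ (v≡u , e)            = trans e v≡u
  ... | inj₂ (inj₁ (_ , e))       = e
  ... | inj₂ (inj₂ (_ , v≢v , _)) = ⊥-elim (v≢v refl)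

  transpose-fixes : ∀ u v x → x ≢ u → x ≢ v → transpose u v x ≡ x
  transpose-fixes u v x x≢u x≢v with transpose-cases u v x
  ... | inj₁ (x≡u , _)          = ⊥-elim (x≢u x≡u)
  ... | inj₂ (inj₁ (x≡v , _))   = ⊥-elim (x≢v x≡v)
  ... | inj₂ (inj₂ (_ , _ , e)) = e

  transpose-involutive : ∀ u v x → transpose u v (transpose u v x) ≡ x
  transpose-involutive u v x with transpose-cases u v x
  ... | inj₁ (x≡u , e)          = trans (cong (transpose u v) e) (trans (transpose-right u v) (sym x≡u))
  ... | inj₂ (inj₁ (x≡v , e))   = trans (cong (transpose u v) e) (trans (transpose-left u v) (sym x≡v))
  ... | inj₂ (inj₂ (_ , _ , e)) = trans (cong (transpose u v) e) e

  transposition : ∀ u v → SamePart u v → u < n → v < n → Symmetry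
  transposition u v uv u<n v<n = record
    { to = transpose u v ; from = transpose u v
    ; from-to = transpose-involutive u v ; to-from = transpose-involutive u v
    ; to-resp = resp ; from-resp = resp }
    where
    resp : Respects (transpose u v)
    resp x with transpose-cases u v x
    ... | inj₁ (refl , e)          rewrite e = uv , λ _ → v<n
    ... | inj₂ (inj₁ (refl , e))   rewrite e = samePart-sym uv , λ _ → u<n
    ... | inj₂ (inj₂ (_ , _ , e))  rewrite e = samePart-refl x , λ x<n → x<n

  matching : ∀ {cs ss} → Pointwise SamePart cs ss → Unique cs → Unique ss → All (_< n) cs → All (_< n) ss →
             Σ Symmetry λ σ → map (to σ) cs ≡ ss
  matching [] _ _ _ _ = identity , refl
  matching {c ∷ cs} {s ∷ ss} (c~s ∷ rest) (c∉cs ∷ ucs) (s∉ss ∷ uss) (c<n ∷ cs<n) (s<n ∷ ss<n)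
    with matching rest ucs uss cs<n ss<n
  ... | σ , σcs≡ss = σ ∘ˢ τ , cong₂ _∷_ hits (trans (map-cong-local fixes) σcs≡ss)
    where
    -- first move c to the preimage t of s, then apply σ
    t : ℕ
    t = from σ s
    τ : Symmetry
    τ = transposition c t (samePart-trans c~s (proj₁ (from-resp σ s))) c<n (proj₂ (from-resp σ s) s<n)
    hits : to σ (transpose c t c) ≡ s
    hits = trans (cong (to σ) (transpose-left c t)) (to-from σ s)
    c′≢t : ∀ {c′} → c′ ∈ cs → c′ ≢ t
    c′≢t c′∈cs refl =
      All.lookup s∉ss (subst (s ∈_) σcs≡ss (subst (_∈ map (to σ) cs) (to-from σ s) (∈-map⁺ (to σ) c′∈cs))) refl
    fixes : All (λ c′ → to σ (transpose c t c′) ≡ to σ c′) cs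
    fixes = All.tabulate λ {c′} c′∈cs →
      cong (to σ) (transpose-fixes c t c′ (λ c′≡c → All.lookup c∉cs c′∈cs (sym c′≡c)) (c′≢t c′∈cs))

  ∈-map-to⁻ : ∀ σ {l x} → x ∈ map (to σ) l → from σ x ∈ l
  ∈-map-to⁻ σ {l} {x} x∈ = ∈-map-inj⁻ (to-injective σ) (subst (_∈ map (to σ) l) (sym (to-from σ x)) x∈)

  transport : ∀ {T T′ : ℕ → Set} {k} (σ : Symmetry) →
              (∀ x → T′ x → T (to σ x)) → (∀ x → T x → T′ (from σ x)) → System T′ k → System T k
  transport {T} {T′} σ T′⇒T T⇒T′ (Ps , size , disjoint) =
    map move Ps , trans (length-map move Ps) size ,
    AllPairs.map⁺ (AllPairs.map (λ {P} {Q} → moveDisjoint (seq P) (seq Q)) disjoint)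
    where
    move : TPath T′ → TPath T
    move P = tpath (map (to σ) (seq P))
      (kpath (Unique.map⁺ (to-injective σ) (unique (isPath P)))
             (Linked.map⁺ (Linked.map (λ {x} {y} → cross-resp (proj₁ (to-resp σ x)) (proj₁ (to-resp σ y)))
                                      (alternating (isPath P))))
             (All.map⁺ (All.map (λ {x} → proj₂ (to-resp σ x)) (inRange (isPath P)))))
      (λ x tx → subst (_∈ map (to σ) (seq P)) (to-from σ x) (∈-map⁺ (to σ) (through P (from σ x) (T⇒T′ x tx))))
    pullEdge : ∀ {l x y} → Edge (map (to σ) l) x y → Edge l (from σ x) (from σ y)
    pullEdge {l} {x} {y} e =
      edge-map-inj⁻ (to-injective σ) (subst₂ (Edge (map (to σ) l)) (sym (to-from σ x)) (sym (to-from σ y)) e)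
    moveDisjoint : ∀ l l′ → Disjoint T′ l l′ → Disjoint T (map (to σ) l) (map (to σ) l′)
    moveDisjoint l l′ (noEdge , shared) =
      (λ x y e e′ → noEdge (from σ x) (from σ y) (pullEdge e) (pullEdge e′)) ,
      (λ x x∈ x∈′ → subst T (to-from σ x) (T′⇒T _ (shared _ (∈-map-to⁻ σ x∈) (∈-map-to⁻ σ x∈′))))

  bySymmetry : ∀ {cs ss k} → Pointwise SamePart cs ss → Unique cs → Unique ss → All (_< n) cs → All (_< n) ss →
               System (_∈ cs) k → System (_∈ ss) k
  bySymmetry cs~ss ucs uss cs<n ss<n with matching cs~ss ucs uss cs<n ss<n
  ... | σ , refl = transport σ (λ _ → ∈-map⁺ (to σ)) (λ _ → ∈-map-to⁻ σ)

  retarget : ∀ {T T′ : ℕ → Set} {k} → (∀ x → T x → T′ x) → (∀ x → T′ x → T x) → System T k → System T′ k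
  retarget {T} {T′} T⇒T′ T′⇒T (Ps , size , disjoint) =
    map move Ps , trans (length-map move Ps) size ,
    AllPairs.map⁺ (AllPairs.map (Product.map₂ (λ shared x x∈ x∈′ → T⇒T′ x (shared x x∈ x∈′))) disjoint)
    where
    move : TPath T → TPath T′
    move P = tpath (seq P) (isPath P) (λ x t′ → through P x (T′⇒T x t′))

  reorder : ∀ {xs ys k} → xs ↭ ys → System (_∈ xs) k → System (_∈ ys) k
  reorder xs↭ys = retarget (λ _ → ∈-resp-↭ xs↭ys) (λ _ → ∈-resp-↭ (↭-sym xs↭ys))

  -- Every vertex of f i that is not a
  -- terminal is owned by i, and only f 0 may contain an edge joining two terminals; so
  -- distinct paths share only terminals, and no edge (a shared edge joins two terminals).
  assemble : ∀ {T : ℕ → Set} k (f : ℕ → List ℕ) (owner : ℕ → ℕ) →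
             (∀ i → i < k → KPath (f i) × Through T (f i)) →
             (∀ i → i < k → ∀ x → x ∈ f i → T x ⊎ owner x ≡ i) →
             (∀ i → suc i < k → ∀ x y → Step (f (suc i)) x y → T x → T y → ⊥) →
             System T k
  assemble {T} k f owner valid owned inner = tabulate P , length-tabulate P , AllPairs.tabulate⁺ apart
    where
    P : Fin k → TPath T
    P i = tpath (f (toℕ i)) (proj₁ (valid (toℕ i) (toℕ<n i))) (proj₂ (valid (toℕ i) (toℕ<n i)))

    common : ∀ {i j} → i ≢ j → i < k → j < k → ∀ x → x ∈ f i → x ∈ f j → T x
    common {i} {j} i≢j i<k j<k x x∈i x∈j with owned i i<k x x∈i | owned j j<k x x∈j
    ... | inj₁ tx | _       = tx
    ... | inj₂ _  | inj₁ tx = tx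
    ... | inj₂ oi | inj₂ oj = ⊥-elim (i≢j (trans (sym oi) oj))

    innerEdge : ∀ i → suc i < k → ∀ {x y} → Edge (f (suc i)) x y → T x → T y → ⊥
    innerEdge i si<k (inj₁ s) tx ty = inner i si<k _ _ s tx ty
    innerEdge i si<k (inj₂ s) tx ty = inner i si<k _ _ s ty tx

    terminalEdge : ∀ i j → i ≢ j → i < k → j < k → ∀ {x y} → Edge (f i) x y → Edge (f j) x y → T x → T y → ⊥
    terminalEdge (suc i) _       _   si<k _    ei _  = innerEdge i si<k ei
    terminalEdge zero    (suc j) _   _    sj<k _  ej = innerEdge j sj<k ej
    terminalEdge zero    zero    0≢0 _    _    _  _  = ⊥-elim (0≢0 refl)

    apart : ∀ {i j : Fin k} → i ≢ j → Disjoint T (seq (P i)) (seq (P j))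
    apart {i} {j} i≢j = noEdge , shared
      where
      ij : toℕ i ≢ toℕ j
      ij e = i≢j (toℕ-injective e)
      shared : ∀ x → x ∈ f (toℕ i) → x ∈ f (toℕ j) → T x
      shared = common ij (toℕ<n i) (toℕ<n j)
      noEdge : ∀ x y → Edge (f (toℕ i)) x y → Edge (f (toℕ j)) x y → ⊥
      noEdge x y ei ej = terminalEdge _ _ ij (toℕ<n i) (toℕ<n j) ei ej
        (shared x (proj₁ (edge-∈ ei)) (proj₁ (edge-∈ ej))) (shared y (proj₂ (edge-∈ ei)) (proj₂ (edge-∈ ej)))

  -- Consecutive vertices of a path lie in different parts, so when all terminals lie in
  -- one part no edge joins two terminals.
  oneSide-inner : ∀ {T : ℕ → Set} {l} → KPath l → (∀ {x} → T x → x < a) ⊎ (∀ {x} → T x → a ≤ x) →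
                  ∀ x y → Step l x y → T x → T y → ⊥
  oneSide-inner π side x y s tx ty with step-rel (alternating π) s | side
  ... | inj₁ (_ , a≤y) | inj₁ inA = <⇒≱ (inA ty) a≤y
  ... | inj₂ (a≤x , _) | inj₁ inA = <⇒≱ (inA tx) a≤x
  ... | inj₁ (x<a , _) | inj₂ inB = <⇒≱ x<a (inB tx)
  ... | inj₂ (_ , y<a) | inj₂ inB = <⇒≱ y<a (inB ty)

  byPart : (ℕ → ℕ) → (ℕ → ℕ) → ℕ → ℕ
  byPart f g x with x <? a
  ... | yes _ = f x
  ... | no _  = g (x ∸ a)

  byPart-A : ∀ f g {x} → x < a → byPart f g x ≡ f x
  byPart-A f g {x} x<a with x <? a
  ... | yes _   = refl
  ... | no x≮a = ⊥-elim (x≮a x<a)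

  byPart-B : ∀ f g j → byPart f g (B j) ≡ g j
  byPart-B f g j with B j <? a
  ... | yes Bj<a = ⊥-elim (<⇒≱ Bj<a (a≤B j))
  ... | no _     = cong g (m+n∸m≡n a j)

  module LowerBound (k : ℕ) (1≤k : 1 ≤ k) (k+k≤a : k + k ≤ a) (a≤b : a ≤ b) where

    2≤a : 2 ≤ a
    2≤a = ≤-trans (+-mono-≤ 1≤k 1≤k) k+k≤a

    0<a : 0 < a
    0<a = ≤-trans (s≤s z≤n) 2≤a

    k<a : k < a
    k<a = <-≤-trans (m<m+n k 1≤k) k+k≤a

    A<b : ∀ {x} → x < a → x < b
    A<b x<a = <-≤-trans x<a a≤b

    -- path i uses the labels 2i and 2i + 1, which stay below 2k ≤ a
    double< : ∀ {i} → i < k → suc (i + i) < a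
    double< {i} i<k = ≤-trans (≤-reflexive (cong suc (sym (+-suc i i)))) (≤-trans (+-mono-≤ i<k i<k) k+k≤a)

    double<′ : ∀ {j} → suc j < k → suc (suc (suc (j + j))) < a
    double<′ {j} sj<k = subst (λ t → suc (suc t) < a) (+-suc j j) (double< sj<k)

    ⌊double/2⌋ : ∀ i → ⌊ i + i /2⌋ ≡ i
    ⌊double/2⌋ i = sym (n≡⌊n+n/2⌋ i)

    ⌊double+1/2⌋ : ∀ i → ⌊ suc (i + i) /2⌋ ≡ i
    ⌊double+1/2⌋ i = sym (n≡⌈n+n/2⌉ i)

    allA : 3 ≤ a → System (_∈ 0 ∷ 1 ∷ 2 ∷ []) k
    allA 3≤a = assemble k route (λ x → ⌊ x ∸ a /2⌋) valid owned
                 (λ i si<k → oneSide-inner (proj₁ (valid (suc i) si<k)) (inj₁ (All.lookup inA)))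
      where
      inA : All (_< a) (0 ∷ 1 ∷ 2 ∷ [])
      inA = 0<a ∷ 2≤a ∷ 3≤a ∷ []
      route : ℕ → List ℕ
      route i = interleave (0 ∷ 1 ∷ 2 ∷ []) (map B (i + i ∷ suc (i + i) ∷ []))
      valid : ∀ i → i < k → KPath (route i) × Through (_∈ 0 ∷ 1 ∷ 2 ∷ []) (route i)
      valid i i<k = proj₂ (zigzag ((<⇒≢ (n<1+n _) ∷ []) ∷ [] ∷ [])
                                   (A<b (<-trans (n<1+n _) (double< i<k)) ∷ A<b (double< i<k) ∷ [])
                                   (((λ ()) ∷ (λ ()) ∷ []) ∷ ((λ ()) ∷ []) ∷ [] ∷ []) inA) ,
                    λ { _ (here refl) → here refl
                      ; _ (there (here refl)) → there (there (here refl))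
                      ; _ (there (there (here refl))) → there (there (there (there (here refl)))) }
      owned : ∀ i → i < k → ∀ x → x ∈ route i → x ∈ 0 ∷ 1 ∷ 2 ∷ [] ⊎ ⌊ x ∸ a /2⌋ ≡ i
      owned i _ _ (here refl)                                 = inj₁ (here refl)
      owned i _ _ (there (here refl))                         = inj₂ (trans (cong ⌊_/2⌋ (m+n∸m≡n a _)) (⌊double/2⌋ i))
      owned i _ _ (there (there (here refl)))                 = inj₁ (there (here refl))
      owned i _ _ (there (there (there (here refl))))         = inj₂ (trans (cong ⌊_/2⌋ (m+n∸m≡n a _)) (⌊double+1/2⌋ i))
      owned i _ _ (there (there (there (there (here refl))))) = inj₁ (there (there (here refl)))

    allB : 3 ≤ b → System (_∈ B 0 ∷ B 1 ∷ B 2 ∷ []) k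
    allB 3≤b = assemble k route ⌊_/2⌋ valid owned
                 (λ i si<k → oneSide-inner (proj₁ (valid (suc i) si<k)) (inj₂ (All.lookup inB)))
      where
      inB : All (a ≤_) (B 0 ∷ B 1 ∷ B 2 ∷ [])
      inB = a≤B 0 ∷ a≤B 1 ∷ a≤B 2 ∷ []
      route : ℕ → List ℕ
      route i = interleave (map B (0 ∷ 1 ∷ 2 ∷ [])) (i + i ∷ suc (i + i) ∷ [])
      valid : ∀ i → i < k → KPath (route i) × Through (_∈ B 0 ∷ B 1 ∷ B 2 ∷ []) (route i)
      valid i i<k = proj₁ (zigzag (((λ ()) ∷ (λ ()) ∷ []) ∷ ((λ ()) ∷ []) ∷ [] ∷ [])
                                   (≤-trans (s≤s z≤n) 3≤b ∷ ≤-trans (s≤s (s≤s z≤n)) 3≤b ∷ 3≤b ∷ [])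
                                   ((<⇒≢ (n<1+n _) ∷ []) ∷ [] ∷ [])
                                   (<-trans (n<1+n _) (double< i<k) ∷ double< i<k ∷ [])) ,
                    λ { _ (here refl) → here refl
                      ; _ (there (here refl)) → there (there (here refl))
                      ; _ (there (there (here refl))) → there (there (there (there (here refl)))) }
      owned : ∀ i → i < k → ∀ x → x ∈ route i → x ∈ B 0 ∷ B 1 ∷ B 2 ∷ [] ⊎ ⌊ x /2⌋ ≡ i
      owned i _ _ (here refl)                                 = inj₁ (here refl)
      owned i _ _ (there (here refl))                         = inj₂ (⌊double/2⌋ i)
      owned i _ _ (there (there (here refl)))                 = inj₁ (there (here refl))
      owned i _ _ (there (there (there (here refl))))         = inj₂ (⌊double+1/2⌋ i)
      owned i _ _ (there (there (there (there (here refl))))) = inj₁ (there (there (here refl)))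

    -- Terminals 0, 1 in A and B0: route 0 is B0, 0, B1, 1, and route (j+1) is
    -- B0, j+2, B(2j+2), 0, B(2j+3), 1; only route 0 has an edge between terminals.
    twoA : System (_∈ 0 ∷ 1 ∷ B 0 ∷ []) k
    twoA = assemble k route owner valid owned inner
      where
      T : ℕ → Set
      T = _∈ 0 ∷ 1 ∷ B 0 ∷ []
      route : ℕ → List ℕ
      route zero    = interleave (map B (0 ∷ 1 ∷ [])) (0 ∷ 1 ∷ [])
      route (suc j) = interleave (map B (0 ∷ suc (suc (j + j)) ∷ suc (suc (suc (j + j))) ∷ []))
                                 (suc (suc j) ∷ 0 ∷ 1 ∷ [])
      owner : ℕ → ℕ
      owner = byPart (_∸ 1) ⌊_/2⌋
      j+2<a : ∀ {j} → suc j < k → suc (suc j) < a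
      j+2<a sj<k = ≤-<-trans sj<k k<a
      valid : ∀ i → i < k → KPath (route i) × Through T (route i)
      valid zero _ = proj₁ (zigzag (((λ ()) ∷ []) ∷ [] ∷ []) (A<b 0<a ∷ A<b 2≤a ∷ [])
                                   (((λ ()) ∷ []) ∷ [] ∷ []) (0<a ∷ 2≤a ∷ [])) ,
                     λ { _ (here refl) → there (here refl)
                       ; _ (there (here refl)) → there (there (there (here refl)))
                       ; _ (there (there (here refl))) → here refl }
      valid (suc j) sj<k =
        proj₁ (zigzag (((λ ()) ∷ (λ ()) ∷ []) ∷ (<⇒≢ (n<1+n _) ∷ []) ∷ [] ∷ [])
                      (A<b 0<a ∷ A<b (<-trans (n<1+n _) (double<′ sj<k)) ∷ A<b (double<′ sj<k) ∷ [])
                      (((λ ()) ∷ (λ ()) ∷ []) ∷ ((λ ()) ∷ []) ∷ [] ∷ [])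
                      (j+2<a sj<k ∷ 0<a ∷ 2≤a ∷ [])) ,
        λ { _ (here refl) → there (there (there (here refl)))
          ; _ (there (here refl)) → there (there (there (there (there (here refl)))))
          ; _ (there (there (here refl))) → here refl }
      owned : ∀ i → i < k → ∀ x → x ∈ route i → T x ⊎ owner x ≡ i
      owned zero    _    _ (here refl)                         = inj₁ (there (there (here refl)))
      owned zero    _    _ (there (here refl))                 = inj₁ (here refl)
      owned zero    _    _ (there (there (here refl)))         = inj₂ (byPart-B _ _ 1)
      owned zero    _    _ (there (there (there (here refl)))) = inj₁ (there (here refl))
      owned (suc j) _    _ (here refl)                         = inj₁ (there (there (here refl)))
      owned (suc j) sj<k _ (there (here refl))                 = inj₂ (byPart-A _ _ (j+2<a sj<k))
      owned (suc j) _    _ (there (there (here refl)))         =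
        inj₂ (trans (byPart-B _ _ _) (cong suc (⌊double/2⌋ j)))
      owned (suc j) _    _ (there (there (there (here refl)))) = inj₁ (here refl)
      owned (suc j) _    _ (there (there (there (there (here refl))))) =
        inj₂ (trans (byPart-B _ _ _) (cong suc (⌊double+1/2⌋ j)))
      owned (suc j) _    _ (there (there (there (there (there (here refl)))))) = inj₁ (there (here refl))
      notT-B : ∀ m → T (B (suc m)) → ⊥
      notT-B m = ∉3 (B≢A 0<a) (B≢A 2≤a) (λ e → 1+n≢0 (B-injective e))
      inner : ∀ j → suc j < k → ∀ x y → Step (route (suc j)) x y → T x → T y → ⊥
      inner j sj<k _ _ here _ ty = ∉3 (λ ()) (λ ()) (A≢B (j+2<a sj<k) (a≤B 0)) ty
      inner j sj<k _ _ (there here) tx _ = ∉3 (λ ()) (λ ()) (A≢B (j+2<a sj<k) (a≤B 0)) tx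
      inner j _ _ _ (there (there here)) tx _ = notT-B _ tx
      inner j _ _ _ (there (there (there here))) _ ty = notT-B _ ty
      inner j _ _ _ (there (there (there (there here)))) tx _ = notT-B _ tx
      inner j _ _ _ (there (there (there (there (there (there ())))))) _ _

    -- Terminals 0 in A and B0, B1: route 0 is B0, 0, B1, and route (j+1) is
    -- B0, 2j+1, B1, 2j+2, B(j+2), 0; only route 0 has an edge between terminals.
    oneA : System (_∈ 0 ∷ B 0 ∷ B 1 ∷ []) k
    oneA = assemble k route owner valid owned inner
      where
      T : ℕ → Set
      T = _∈ 0 ∷ B 0 ∷ B 1 ∷ []
      route : ℕ → List ℕ
      route zero    = interleave (map B (0 ∷ 1 ∷ [])) (0 ∷ [])
      route (suc j) = interleave (map B (0 ∷ 1 ∷ suc (suc j) ∷ []))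
                                 (suc (j + j) ∷ suc (suc (j + j)) ∷ 0 ∷ [])
      owner : ℕ → ℕ
      owner = byPart ⌈_/2⌉ (_∸ 1)
      j+2<b : ∀ {j} → suc j < k → suc (suc j) < b
      j+2<b sj<k = A<b (≤-<-trans sj<k k<a)
      2j+2<a : ∀ {j} → suc j < k → suc (suc (j + j)) < a
      2j+2<a sj<k = <-trans (n<1+n _) (double<′ sj<k)
      2j+1<a : ∀ {j} → suc j < k → suc (j + j) < a
      2j+1<a sj<k = <-trans (n<1+n _) (2j+2<a sj<k)
      valid : ∀ i → i < k → KPath (route i) × Through T (route i)
      valid zero _ = proj₁ (zigzag (((λ ()) ∷ []) ∷ [] ∷ []) (A<b 0<a ∷ A<b 2≤a ∷ []) ([] ∷ []) (0<a ∷ [])) ,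
                     λ { _ (here refl) → there (here refl)
                       ; _ (there (here refl)) → here refl
                       ; _ (there (there (here refl))) → there (there (here refl)) }
      valid (suc j) sj<k =
        proj₁ (zigzag (((λ ()) ∷ (λ ()) ∷ []) ∷ ((λ ()) ∷ []) ∷ [] ∷ [])
                      (A<b 0<a ∷ A<b 2≤a ∷ j+2<b sj<k ∷ [])
                      ((<⇒≢ (n<1+n _) ∷ (λ ()) ∷ []) ∷ ((λ ()) ∷ []) ∷ [] ∷ [])
                      (2j+1<a sj<k ∷ 2j+2<a sj<k ∷ 0<a ∷ [])) ,
        λ { _ (here refl) → there (there (there (there (there (here refl)))))
          ; _ (there (here refl)) → here refl
          ; _ (there (there (here refl))) → there (there (here refl)) }
      owned : ∀ i → i < k → ∀ x → x ∈ route i → T x ⊎ owner x ≡ i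
      owned zero    _    _ (here refl)                 = inj₁ (there (here refl))
      owned zero    _    _ (there (here refl))         = inj₁ (here refl)
      owned zero    _    _ (there (there (here refl))) = inj₁ (there (there (here refl)))
      owned (suc j) _    _ (here refl)                 = inj₁ (there (here refl))
      owned (suc j) sj<k _ (there (here refl))         =
        inj₂ (trans (byPart-A _ _ (2j+1<a sj<k)) (cong suc (⌊double/2⌋ j)))
      owned (suc j) _    _ (there (there (here refl))) = inj₁ (there (there (here refl)))
      owned (suc j) sj<k _ (there (there (there (here refl)))) =
        inj₂ (trans (byPart-A _ _ (2j+2<a sj<k)) (cong suc (⌊double+1/2⌋ j)))
      owned (suc j) _    _ (there (there (there (there (here refl))))) = inj₂ (byPart-B _ _ _)
      owned (suc j) _    _ (there (there (there (there (there (here refl)))))) = inj₁ (here refl)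
      notT-A : ∀ {x} → 0 < x → x < a → T x → ⊥
      notT-A {suc _} _ x<a = ∉3 (λ ()) (A≢B x<a (a≤B 0)) (A≢B x<a (a≤B 1))
      notT-B : ∀ m → T (B (suc (suc m))) → ⊥
      notT-B m = ∉3 (B≢A 0<a) (λ e → 1+n≢0 (B-injective e)) (λ e → 1+n≢0 (suc-injective (B-injective e)))
      inner : ∀ j → suc j < k → ∀ x y → Step (route (suc j)) x y → T x → T y → ⊥
      inner j sj<k _ _ here _ ty = notT-A (s≤s z≤n) (2j+1<a sj<k) ty
      inner j sj<k _ _ (there here) tx _ = notT-A (s≤s z≤n) (2j+1<a sj<k) tx
      inner j sj<k _ _ (there (there here)) _ ty = notT-A (s≤s z≤n) (2j+2<a sj<k) ty
      inner j sj<k _ _ (there (there (there here))) tx _ = notT-A (s≤s z≤n) (2j+2<a sj<k) tx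
      inner j _ _ _ (there (there (there (there here)))) tx _ = notT-B j tx
      inner j _ _ _ (there (there (there (there (there (there ())))))) _ _

    withAllA : ∀ {p q r} → p ≢ q → p ≢ r → q ≢ r → p < a → q < a → r < a → System (_∈ p ∷ q ∷ r ∷ []) k
    withAllA p≢q p≢r q≢r p<a q<a r<a =
      bySymmetry (A~ 0<a p<a ∷ A~ 2≤a q<a ∷ A~ 3≤a r<a ∷ [])
                 (((λ ()) ∷ (λ ()) ∷ []) ∷ ((λ ()) ∷ []) ∷ [] ∷ []) ((p≢q ∷ p≢r ∷ []) ∷ (q≢r ∷ []) ∷ [] ∷ [])
                 (A<n 0<a ∷ A<n 2≤a ∷ A<n 3≤a ∷ []) (A<n p<a ∷ A<n q<a ∷ A<n r<a ∷ [])
                 (allA 3≤a)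
      where
      3≤a : 3 ≤ a
      3≤a = subst (3 ≤_) (length-upTo a) (three≤length p≢q p≢r q≢r (∈-upTo⁺ p<a) (∈-upTo⁺ q<a) (∈-upTo⁺ r<a))

    withAllB : ∀ {p q r} → p ≢ q → p ≢ r → q ≢ r → a ≤ p → a ≤ q → a ≤ r → p < n → q < n → r < n →
               System (_∈ p ∷ q ∷ r ∷ []) k
    withAllB p≢q p≢r q≢r a≤p a≤q a≤r p<n q<n r<n =
      bySymmetry (B~ (a≤B 0) a≤p ∷ B~ (a≤B 1) a≤q ∷ B~ (a≤B 2) a≤r ∷ [])
                 (((λ e → 1+n≢0 (sym (B-injective e))) ∷ (λ e → 1+n≢0 (sym (B-injective e))) ∷ []) ∷
                  ((λ e → 1+n≢0 (sym (suc-injective (B-injective e)))) ∷ []) ∷ [] ∷ [])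
                 ((p≢q ∷ p≢r ∷ []) ∷ (q≢r ∷ []) ∷ [] ∷ [])
                 (B<n (≤-trans (s≤s z≤n) 3≤b) ∷ B<n (≤-trans (s≤s (s≤s z≤n)) 3≤b) ∷ B<n 3≤b ∷ [])
                 (p<n ∷ q<n ∷ r<n ∷ [])
                 (allB 3≤b)
      where
      3≤b : 3 ≤ b
      3≤b = subst (3 ≤_) (length-applyUpTo B b) (three≤length p≢q p≢r q≢r (B-enumerates a≤p p<n) (B-enumerates a≤q q<n) (B-enumerates a≤r r<n))

    withTwoA : ∀ {p q r} → p ≢ q → p < a → q < a → a ≤ r → r < n → System (_∈ p ∷ q ∷ r ∷ []) k
    withTwoA p≢q p<a q<a a≤r r<n =
      bySymmetry (A~ 0<a p<a ∷ A~ 2≤a q<a ∷ B~ (a≤B 0) a≤r ∷ [])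
                 (((λ ()) ∷ A≢B 0<a (a≤B 0) ∷ []) ∷ (A≢B 2≤a (a≤B 0) ∷ []) ∷ [] ∷ [])
                 ((p≢q ∷ A≢B p<a a≤r ∷ []) ∷ (A≢B q<a a≤r ∷ []) ∷ [] ∷ [])
                 (A<n 0<a ∷ A<n 2≤a ∷ B<n (A<b 0<a) ∷ []) (A<n p<a ∷ A<n q<a ∷ r<n ∷ [])
                 twoA

    withOneA : ∀ {p q r} → q ≢ r → p < a → a ≤ q → a ≤ r → q < n → r < n → System (_∈ p ∷ q ∷ r ∷ []) k
    withOneA q≢r p<a a≤q a≤r q<n r<n =
      bySymmetry (A~ 0<a p<a ∷ B~ (a≤B 0) a≤q ∷ B~ (a≤B 1) a≤r ∷ [])
                 ((A≢B 0<a (a≤B 0) ∷ A≢B 0<a (a≤B 1) ∷ []) ∷ ((λ e → 1+n≢0 (sym (B-injective e))) ∷ []) ∷ [] ∷ [])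
                 ((A≢B p<a a≤q ∷ A≢B p<a a≤r ∷ []) ∷ (q≢r ∷ []) ∷ [] ∷ [])
                 (A<n 0<a ∷ B<n (A<b 0<a) ∷ B<n (A<b 2≤a) ∷ []) (A<n p<a ∷ q<n ∷ r<n ∷ [])
                 oneA

    lowerBound : ∀ ts → length ts ≡ 3 → Unique ts → All (_< n) ts → System (_∈ ts) k
    lowerBound (p ∷ q ∷ r ∷ []) _ ((p≢q ∷ p≢r ∷ []) ∷ (q≢r ∷ []) ∷ [] ∷ []) (p<n ∷ q<n ∷ r<n ∷ [])
      with p <? a | q <? a | r <? a
    ... | yes p<a | yes q<a | yes r<a = withAllA p≢q p≢r q≢r p<a q<a r<a
    ... | no  p≮a | no  q≮a | no  r≮a = withAllB p≢q p≢r q≢r (≮⇒≥ p≮a) (≮⇒≥ q≮a) (≮⇒≥ r≮a) p<n q<n r<n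
    ... | yes p<a | yes q<a | no  r≮a = withTwoA p≢q p<a q<a (≮⇒≥ r≮a) r<n
    ... | yes p<a | no  q≮a | yes r<a = reorder (prep p (swap r q ↭-refl)) (withTwoA p≢r p<a r<a (≮⇒≥ q≮a) q<n)
    ... | no  p≮a | yes q<a | yes r<a =
      reorder (↭-sym (↭-trans (swap p q ↭-refl) (prep q (swap p r ↭-refl)))) (withTwoA q≢r q<a r<a (≮⇒≥ p≮a) p<n)
    ... | yes p<a | no  q≮a | no  r≮a = withOneA q≢r p<a (≮⇒≥ q≮a) (≮⇒≥ r≮a) q<n r<n
    ... | no  p≮a | yes q<a | no  r≮a = reorder (swap q p ↭-refl) (withOneA p≢r q<a (≮⇒≥ p≮a) (≮⇒≥ r≮a) p<n r<n)
    ... | no  p≮a | no  q≮a | yes r<a =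
      reorder (↭-sym (↭-trans (prep p (swap q r ↭-refl)) (swap p r ↭-refl))) (withOneA p≢q r<a (≮⇒≥ p≮a) (≮⇒≥ q≮a) p<n q<n)

    lowerBoundSet : (S : Subset n) → ∣ S ∣ ≡ 3 → HasDisjointSPaths (K a b) S k
    lowerBoundSet S size =
      realise S (_∈ memberLabels S) (λ v v∈S → ∈-map⁺ toℕ (elements-complete S v∈S))
                                    (λ v v∈ts → elements-sound S (∈-map-inj⁻ toℕ-injective v∈ts))
        (lowerBound (memberLabels S) (trans (memberLabels-length S) size) (memberLabels-unique S)
                    (All.map⁺ (All.universal toℕ<n (elements S))))

  -- Upper bound.  A path through three B-vertices alternates between the parts, so it has
  -- at least two A-vertices; these are not terminals, hence private to the path.
  Aof : List ℕ → List ℕ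
  Aof = filter (_<? a)

  Bof : List ℕ → List ℕ
  Bof = filter (a ≤?_)

  balanceA : ∀ {x l} → Linked Cross (x ∷ l) → x < a → length (Bof (x ∷ l)) ≤ length (Aof (x ∷ l))
  balanceB : ∀ {x l} → Linked Cross (x ∷ l) → a ≤ x → length (Bof (x ∷ l)) ≤ suc (length (Aof (x ∷ l)))

  balanceA {x} {l} alt x<a
    rewrite filter-reject (a ≤?_) {x} {l} (<⇒≱ x<a) | filter-accept (_<? a) {x} {l} x<a = rest l alt
    where
    rest : ∀ l → Linked Cross (x ∷ l) → length (Bof l) ≤ suc (length (Aof l))
    rest []      _                      = z≤n
    rest (y ∷ l) (inj₁ (_ , a≤y) ∷ alt) = balanceB alt a≤y
    rest (y ∷ l) (inj₂ (a≤x , _) ∷ _)   = ⊥-elim (<⇒≱ x<a a≤x)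

  balanceB {x} {l} alt a≤x
    rewrite filter-accept (a ≤?_) {x} {l} a≤x | filter-reject (_<? a) {x} {l} (≤⇒≯ a≤x) = s≤s (rest l alt)
    where
    rest : ∀ l → Linked Cross (x ∷ l) → length (Bof l) ≤ length (Aof l)
    rest []      _                      = z≤n
    rest (y ∷ l) (inj₂ (_ , y<a) ∷ alt) = balanceA alt y<a
    rest (y ∷ l) (inj₁ (x<a , _) ∷ _)   = ⊥-elim (<⇒≱ x<a a≤x)

  balance : ∀ {l} → Linked Cross l → length (Bof l) ≤ suc (length (Aof l))
  balance {[]}    _ = z≤n
  balance {x ∷ l} alt with x <? a
  ... | yes x<a = m≤n⇒m≤1+n (balanceA alt x<a)
  ... | no  x≮a = balanceB alt (≮⇒≥ x≮a)

  twoInA : ∀ {l ts} → Linked Cross l → Unique ts → length ts ≡ 3 → All (a ≤_) ts → (∀ {v} → v ∈ ts → v ∈ l) →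
           2 ≤ length (Aof l)
  twoInA {l} {ts} alt uts size ts∈B ts⊆l = s≤s⁻¹ (begin
    3                    ≡⟨ size ⟨
    length ts            ≤⟨ unique-⊆-length uts (λ v∈ → ∈-filter⁺ (a ≤?_) (ts⊆l v∈) (All.lookup ts∈B v∈)) ⟩
    length (Bof l)       ≤⟨ balance alt ⟩
    suc (length (Aof l)) ∎)
    where open ≤-Reasoning

  upperBound : (S : Subset n) → ∣ S ∣ ≡ 3 → (∀ v → v ∈ˢ S → a ≤ toℕ v) →
               ∀ m → HasDisjointSPaths (K a b) S m → m * 2 ≤ a
  upperBound S size S⊆B m (Ps , refl , disjoint) = begin
    length Ps * 2                   ≡⟨ cong (_* 2) (length-map inner Ps) ⟨
    length (map inner Ps) * 2       ≤⟨ length-concat≥ (All.map⁺ (All.universal two Ps)) ⟩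
    length (concat (map inner Ps))  ≤⟨ unique-⊆-length uniqueInner (λ v∈ → ∈-upTo⁺ (All.lookup below v∈)) ⟩
    length (upTo a)                 ≡⟨ length-upTo a ⟩
    a                               ∎
    where
    open ≤-Reasoning
    inner : SPath (K a b) S → List ℕ
    inner P = Aof (labels (path P))
    two : ∀ P → 2 ≤ length (inner P)
    two P = twoInA (Linked.map⁺ (walk (path P))) (memberLabels-unique S) (trans (memberLabels-length S) size)
                   (All.map⁺ (All.tabulate λ v∈ → S⊆B _ (elements-sound S v∈)))
                   (λ v∈ts → let w , w∈ , v≡w = ∈-map⁻ toℕ v∈ts in
                             subst (_∈ labels (path P)) (sym v≡w) (∈-map⁺ toℕ (covers P w (elements-sound S w∈))))
    separate : ∀ {P Q} → InternallyDisjoint P Q → ∀ {v} → ¬ (v ∈ inner P × v ∈ inner Q)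
    separate {P} {Q} (_ , shared) (v∈P , v∈Q) with ∈-filter⁻ (_<? a) v∈P | ∈-filter⁻ (_<? a) v∈Q
    ... | v∈P′ , v<a | v∈Q′ , _ with ∈-map⁻ toℕ v∈P′ | ∈-map⁻ toℕ v∈Q′
    ... | w , w∈P , v≡w | w′ , w′∈Q , v≡w′ with toℕ-injective (trans (sym v≡w) v≡w′)
    ... | refl = <⇒≱ v<a (subst (a ≤_) (sym v≡w) (S⊆B w (shared w w∈P w′∈Q)))
    apartInner : AllPairs (λ P Q → ∀ {v} → ¬ (v ∈ inner P × v ∈ inner Q)) Ps
    apartInner = AllPairs.map (λ {P} {Q} d {v} → separate {P} {Q} d {v}) disjoint
    uniqueInner : Unique (concat (map inner Ps))
    uniqueInner = Unique.concat⁺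
      (All.map⁺ (All.universal (λ P → Unique.filter⁺ (_<? a) (Unique.map⁺ toℕ-injective (distinct (path P)))) Ps))
      (AllPairs.map⁺ apartInner)
    below : All (_< a) (concat (map inner Ps))
    below = All.concat⁺ (All.map⁺ (All.universal (λ P → All.all-filter (_<? a) (labels (path P))) Ps))

-- K_{2,2} is the 4-cycle 0–2–1–3–0, and the set {0, 1, 2} admits no two internally disjoint
-- paths: a path avoiding 3 uses both edges 0–2 and 1–2, while every path uses one of them.
module K₂₂ where

  open import Data.List.Membership.DecPropositional (Data.Fin._≟_ {4}) using (_∈?_)

  S₂₂ : Subset 4
  S₂₂ = true ∷ true ∷ true ∷ false ∷ []

  v₀ v₁ v₂ v₃ : Fin 4
  v₀ = zero
  v₁ = suc zero
  v₂ = suc (suc zero)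
  v₃ = suc (suc (suc zero))

  InA : Fin 4 → Set
  InA u = u ≡ v₀ ⊎ u ≡ v₁

  neighbour-A : ∀ {u w} → InA u → Adj (K 2 2) u w → w ≡ v₂ ⊎ w ≡ v₃
  neighbour-A {w = suc (suc zero)}          _ _ = inj₁ refl
  neighbour-A {w = suc (suc (suc zero))}    _ _ = inj₂ refl
  neighbour-A {w = zero}       (inj₁ refl) (inj₁ (_ , ()))
  neighbour-A {w = zero}       (inj₁ refl) (inj₂ (() , _))
  neighbour-A {w = suc zero}   (inj₁ refl) (inj₁ (_ , s≤s ()))
  neighbour-A {w = suc zero}   (inj₁ refl) (inj₂ (() , _))
  neighbour-A {w = zero}       (inj₂ refl) (inj₁ (_ , ()))
  neighbour-A {w = zero}       (inj₂ refl) (inj₂ (s≤s () , _))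
  neighbour-A {w = suc zero}   (inj₂ refl) (inj₁ (_ , s≤s ()))
  neighbour-A {w = suc zero}   (inj₂ refl) (inj₂ (s≤s () , _))

  neighbour-2 : ∀ {w} → Adj (K 2 2) v₂ w → InA w
  neighbour-2 {zero}                    _ = inj₁ refl
  neighbour-2 {suc zero}                _ = inj₂ refl
  neighbour-2 {suc (suc zero)}          (inj₁ (s≤s (s≤s ()) , _))
  neighbour-2 {suc (suc zero)}          (inj₂ (_ , s≤s (s≤s ())))
  neighbour-2 {suc (suc (suc zero))}    (inj₁ (s≤s (s≤s ()) , _))
  neighbour-2 {suc (suc (suc zero))}    (inj₂ (_ , s≤s (s≤s ())))

  inS : ∀ {u} → InA u → u ∈ˢ S₂₂
  inS (inj₁ refl) = here
  inS (inj₂ refl) = there here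

  v₂∈S : v₂ ∈ˢ S₂₂
  v₂∈S = there (there here)

  v₃∉S : ¬ (v₃ ∈ˢ S₂₂)
  v₃∉S (there (there (there ())))

  A≢v₂ : ∀ {u} → InA u → u ≢ v₂
  A≢v₂ (inj₁ refl) ()
  A≢v₂ (inj₂ refl) ()

  avoiding-v₃ : (P : SPath (K 2 2) S₂₂) → ¬ VertexOf (path P) v₃ → ∀ {u} → InA u → EdgeOf (path P) u v₂
  avoiding-v₃ P v₃∉P u∈A with path-neighbour (path P) (A≢v₂ u∈A) (covers P _ (inS u∈A)) (covers P v₂ v₂∈S)
  ... | w , e with neighbour-A u∈A (edge-adj (path P) e)
  ...   | inj₁ refl = e
  ...   | inj₂ refl = ⊥-elim (v₃∉P (proj₂ (edge-∈ (edgeOf⇒edge (path P) e))))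

  edge-at-v₂ : (P : SPath (K 2 2) S₂₂) → Σ (Fin 4) λ u → InA u × EdgeOf (path P) u v₂
  edge-at-v₂ P with path-neighbour (path P) (λ ()) (covers P v₂ v₂∈S) (covers P v₀ here)
  ... | w , e = w , neighbour-2 (edge-adj (path P) e) , Sum.swap e

  no-disjoint-pair : ∀ (P Q : SPath (K 2 2) S₂₂) → ¬ InternallyDisjoint P Q
  no-disjoint-pair P Q (noEdge , shared) with v₃ ∈? verts (path P) | v₃ ∈? verts (path Q)
  ... | yes v₃∈P | yes v₃∈Q = v₃∉S (shared v₃ v₃∈P v₃∈Q)
  ... | no v₃∉P  | _         = let u , u∈A , e = edge-at-v₂ Q in noEdge u v₂ (avoiding-v₃ P v₃∉P u∈A) e
  ... | yes _    | no v₃∉Q   = let u , u∈A , e = edge-at-v₂ P in noEdge u v₂ e (avoiding-v₃ Q v₃∉Q u∈A)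

  upperBound₂₂ : ∀ m → HasDisjointSPaths (K 2 2) S₂₂ m → m ≤ 1
  upperBound₂₂ _ ([]        , refl , _)            = z≤n
  upperBound₂₂ _ (_ ∷ []    , refl , _)            = s≤s z≤n
  upperBound₂₂ _ (P ∷ Q ∷ _ , _    , (PQ ∷ _) ∷ _) = ⊥-elim (no-disjoint-pair P Q PQ)

shifted : ∀ a {m} → Subset m → Subset (a + m)
shifted a p = Vec.replicate a false Vec.++ p

shifted-size : ∀ a {m} (p : Subset m) → ∣ shifted a p ∣ ≡ ∣ p ∣
shifted-size zero    p = refl
shifted-size (suc a) p = shifted-size a p

shifted-late : ∀ a {m} (p : Subset m) v → v ∈ˢ shifted a p → a ≤ toℕ v
shifted-late zero    p v       _         = z≤n
shifted-late (suc a) p (suc v) (there v∈) = s≤s (shifted-late a p v v∈)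

≤half : ∀ {m x} → m * 2 ≤ x → m ≤ x / 2
≤half {m} {x} m*2≤x = subst (_≤ x / 2) (m*n/n≡m m 2) (/-monoˡ-≤ 2 m*2≤x)

lowerBound : (a b : ℕ) → 2 ≤ a → a ≤ b → (S : Subset (a + b)) → ∣ S ∣ ≡ 3 →
             HasDisjointSPaths (K a b) S (a / 2)
lowerBound a b 2≤a a≤b = KModel.LowerBound.lowerBoundSet a b (a / 2) 1≤k k+k≤a a≤b
  where
  1≤k : 1 ≤ a / 2
  1≤k = m≥n⇒m/n>0 2≤a
  k+k≤a : a / 2 + a / 2 ≤ a
  k+k≤a = subst (_≤ a) (trans (*-comm (a / 2) 2) (cong (a / 2 +_) (+-identityʳ (a / 2)))) (m/n*n≤m a 2)

extremal : (a b : ℕ) → 2 ≤ a → a ≤ b → Σ (Subset (a + b)) λ S → ∣ S ∣ ≡ 3 × IsPiS (K a b) S (a / 2)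
extremal a (suc (suc (suc b))) 2≤a a≤b =
  S , size , lowerBound a _ 2≤a a≤b S size ,
  λ m paths → ≤half (KModel.upperBound a _ S size (shifted-late a _) m paths)
  where
  S : Subset (a + suc (suc (suc b)))
  S = shifted a (true ∷ true ∷ true ∷ ∅)
  size : ∣ S ∣ ≡ 3
  size = trans (shifted-size a _) (cong (λ t → suc (suc (suc t))) (∣⊥∣≡0 b))
extremal a 2 2≤a a≤2 with ≤-antisym a≤2 2≤a
... | refl = K₂₂.S₂₂ , refl , lowerBound 2 2 2≤a a≤2 K₂₂.S₂₂ refl , K₂₂.upperBound₂₂
extremal a 1 2≤a a≤1 = ⊥-elim (<⇒≱ (s≤s (s≤s z≤n)) (≤-trans 2≤a a≤1))
extremal a 0 2≤a a≤0 = ⊥-elim (<⇒≱ (s≤s z≤n) (≤-trans 2≤a a≤0))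

corollary3p2 : (a b : ℕ) → 2 ≤ a → a ≤ b → IsPik (K a b) 3 (a / 2)
corollary3p2 a b 2≤a a≤b =
  extremal a b 2≤a a≤b ,
  λ S size m (_ , maximal) → maximal (a / 2) (lowerBound a b 2≤a a≤b S size)
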